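{- Let $n\ge 2$, let $K_n$ be the complete graph on vertex set $[n]$, and let $r_{{\rm BN},K_n}$ be its Baker–Norine rank. (1) If $i\in\mathbb Z$ and $\mathbf a\in\mathbb Z^n$ satisfies $a_1,\ldots,a_{n-2}\in\{0,\ldots,n-1\}$, $a_{n-1}=0$ and $\deg(\mathbf a)=i$, then $$ \bigl((1-\mathfrak t_n)(1-\mathfrak t_{n-1})r_{{\rm BN},K_n}\bigr)(\mathbf a)=\begin{cases}1&\text{if } a_1+\cdots+a_{n-2}=i,\\0&\text{otherwise.}\end{cases} $$ (2) For all $\mathbf b\in\{0,\ldots,n-1\}^{n-2}$ and $i\in\mathbb Z$, $$ \bigl((1-\mathfrak t_n)(1-\mathfrak t_{n-1})r_{{\rm BN},K_n}\bigr)(\langle\mathbf b,i\rangle)=\begin{cases}1&\text{if } b_1+\cdots+b_{n-2}=i,\\0&\text{otherwise.}\end{cases} $$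
   Context: $\deg(\mathbf d)=d_1+\cdots+d_n$; $\mathbf e_j$ is the $j$-th standard basis vector. For $j\in[n]$, $\mathfrak t_j$ is the downward shift operator $(\mathfrak t_jF)(\mathbf d)=F(\mathbf d-\mathbf e_j)$, and $1$ denotes the identity operator. For $\mathbf b\in\{0,\ldots,n-1\}^{n-2}$ and $i\in\mathbb Z$, $\langle\mathbf b,i\rangle=(b_1,\ldots,b_{n-2},0,i-b_1-\cdots-b_{n-2})\in\mathbb Z^n$. For a connected graph $G$ without self-loops on ordered vertices $v_1,\ldots,v_n$, $\Delta_G$ is its Laplacian viewed as a map $\mathbb Z^n\to\mathbb Z^n$; $\mathbf d\sim\mathbf d'$ iff $\mathbf d-\mathbf d'\in\mathrm{Image}(\Delta_G)$; $\mathcal N$ is the set of $\mathbf d$ not equivalent to any componentwise nonnegative vector; $f(\mathbf d)=\min_{\mathbf d'\in\mathcal N}\|\mathbf d-\mathbf d'\|_1$; $r_{\rm BN}=f-1$. -}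

module Defs where

open import Data.Nat as ℕ using (ℕ; zero; suc)
open import Data.Integer as ℤ using (ℤ; +_; _+_; _-_; _*_; _≤_; ∣_∣)
open import Data.Fin as Fin using (Fin; zero; suc; _↑ˡ_; _↑ʳ_; splitAt)
open import Data.Product using (Σ; ∃; _×_; _,_)
open import Data.Sum using (inj₁; inj₂)
open import Relation.Nullary using (¬_; yes; no)
open import Relation.Binary.PropositionalEquality using (_≡_)

sumℤ : ∀ {n} → (Fin n → ℤ) → ℤ
sumℤ {zero}  f = + 0
sumℤ {suc n} f = f zero + sumℤ (λ j → f (suc j))

sumℕ : ∀ {n} → (Fin n → ℕ) → ℕ
sumℕ {zero}  f = 0
sumℕ {suc n} f = f zero ℕ.+ sumℕ (λ j → f (suc j))

Div : ℕ → Set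
Div n = Fin n → ℤ

deg : ∀ {n} → Div n → ℤ
deg = sumℤ

𝐞 : ∀ {n} → Fin n → Div n
𝐞 j k with j Fin.≟ k
... | yes _ = + 1
... | no  _ = + 0

_⊖_ : ∀ {n} → Div n → Div n → Div n
(d ⊖ d') j = d j - d' j

-- a graph without self-loops (multiplicities allowed) given by its
-- adjacency matrix A (symmetric, zero diagonal)
Adj : ℕ → Set
Adj n = Fin n → Fin n → ℕ

laplacian : ∀ {n} → Adj n → Div n → Div n
laplacian A x i = sumℤ (λ j → (+ A i j) * (x i - x j))

completeAdj : (n : ℕ) → Adj n
completeAdj n i j with i Fin.≟ j
... | yes _ = 0
... | no  _ = 1

_∼[_]_ : ∀ {n} → Div n → Adj n → Div n → Set
d ∼[ A ] d' = Σ (Div _) λ x → ∀ j → (d ⊖ d') j ≡ laplacian A x j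

Nonneg : ∀ {n} → Div n → Set
Nonneg d = ∀ j → + 0 ≤ d j

InN : ∀ {n} → Adj n → Div n → Set
InN A d = ¬ (Σ (Div _) λ e → Nonneg e × (d ∼[ A ] e))

dist₁ : ∀ {n} → Div n → Div n → ℕ
dist₁ d d' = sumℕ (λ j → ∣ d j - d' j ∣)

IsF : ∀ {n} → Adj n → Div n → ℕ → Set
IsF A d m = (Σ (Div _) λ d' → InN A d' × (dist₁ d d' ≡ m))
          × (∀ d' → InN A d' → m ℕ.≤ dist₁ d d')

IsRankBN : ∀ {n} → Adj n → Div n → ℤ → Set
IsRankBN A d r = Σ ℕ λ m → IsF A d m × (r ≡ (+ m) - + 1)

-- vertices v_{n-1}, v_n of Fin (k + 2), and v_1..v_{n-2}
vPen : ∀ k → Fin (k ℕ.+ 2)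
vPen k = k ↑ʳ zero

vLast : ∀ k → Fin (k ℕ.+ 2)
vLast k = k ↑ʳ suc zero

vLow : ∀ k → Fin k → Fin (k ℕ.+ 2)
vLow k l = l ↑ˡ 2

⟨_,_⟩ : ∀ {k} → (Fin k → ℤ) → ℤ → Div (k ℕ.+ 2)
⟨_,_⟩ {k} b i j with splitAt k j
... | inj₁ l = b l
... | inj₂ zero = + 0
... | inj₂ (suc zero) = i - sumℤ b

-- ((1 - t_n)(1 - t_{n-1}) F)(d) given the values
--   r₀ = F(d), r₁ = F(d - e_{n-1}), r₂ = F(d - e_n), r₃ = F(d - e_{n-1} - e_n)
secondDiff : ℤ → ℤ → ℤ → ℤ → ℤ
secondDiff r₀ r₁ r₂ r₃ = ((r₀ - r₁) - r₂) + r₃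

-- the statement "((1-t_n)(1-t_{n-1}) r_BN)(d) = v" for K_n, n = k + 2,
-- formulated for every choice of the (unique) values of r_BN
SecondDiffRankIs : ∀ k → Div (k ℕ.+ 2) → ℤ → Set
SecondDiffRankIs k d v =
  ∀ r₀ r₁ r₂ r₃ →
  IsRankBN (completeAdj (k ℕ.+ 2)) d r₀ →
  IsRankBN (completeAdj (k ℕ.+ 2)) (d ⊖ 𝐞 (vPen k)) r₁ →
  IsRankBN (completeAdj (k ℕ.+ 2)) (d ⊖ 𝐞 (vLast k)) r₂ →
  IsRankBN (completeAdj (k ℕ.+ 2)) ((d ⊖ 𝐞 (vPen k)) ⊖ 𝐞 (vLast k)) r₃ →
  secondDiff r₀ r₁ r₂ r₃ ≡ v

-- Write f = r_BN + 1. Since 𝒩 is closed downwards, deg d − f(d) is the largest degree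
-- of a divisor of 𝒩 below d, so f(d) − f(d − v) ∈ {0, 1} is decided by whether every
-- D ∈ 𝒩 below d has a counterpart of the same degree below d − v. On Kₙ, with d_v = 0:
-- if d ≥ 0, such a D either is already below d − v or has D_v = 0 and a negative entry
-- D_j, and swapping v and j works, so the step is 1. If instead d_w < 0 and d_l < n
-- elsewhere, any E ∈ 𝒩 below d − v can be raised at v inside 𝒩 without losing degree
-- until E_v = −1 (when E + v leaves 𝒩, E + v − j stays in 𝒩 for some j), and then
-- E + v ∈ 𝒩 after all; so the step is 0. For d and d − w, with v = v_{n−1} and w = v_n,
-- this gives the second difference 1 − 1, 1 − 0 or 0 − 0 according to the sign of d_w,
-- and d_w = i − (b_1 + ⋯ + b_{n−2}).
module Submission where

open import Defs
open import Data.Nat as ℕ using (ℕ; zero; suc)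
import Data.Nat.Properties as ℕP
open import Data.Integer as ℤ using (ℤ; +_; _+_; _-_; _*_; _≤_; _<_; _⊓_; ∣_∣; 0ℤ; 1ℤ; -1ℤ)
import Data.Integer.Properties as ℤP
open import Data.Integer.Tactic.RingSolver using (solve-∀)
open import Data.Fin as Fin using (Fin; zero; suc; _≟_; _↑ˡ_; _↑ʳ_)
import Data.Fin.Properties as FinP
open import Data.Fin.Permutation as Perm using (Permutation′; _⟨$⟩ʳ_)
import Data.Fin.Permutation.Components as PC
import Algebra.Properties.CommutativeMonoid.Sum ℤP.+-0-commutativeMonoid as ℤSum
open import Data.Product as Product using (Σ; _×_; _,_; proj₁; proj₂)
open import Data.Sum using (_⊎_; inj₁; inj₂)
open import Function using (_∘_)
open import Relation.Binary.Definitions using (Tri; tri<; tri≈; tri>)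
open import Relation.Nullary using (¬_; Dec; yes; no; contradiction)
open import Data.Empty using (⊥)
open import Relation.Nullary.Decidable using (decidable-stable)
open import Relation.Binary.PropositionalEquality
  using (_≡_; _≢_; refl; sym; trans; cong; cong₂; subst; subst₂; module ≡-Reasoning)

_⊕_ : ∀ {n} → Div n → Div n → Div n
(d ⊕ d') j = d j + d' j

infix 4 _≤ᵈ_
_≤ᵈ_ : ∀ {n} → Div n → Div n → Set
D ≤ᵈ E = ∀ l → D l ≤ E l

≤-resp-slack : ∀ {a b c d} → a ≤ b → b - a ≡ d - c → c ≤ d
≤-resp-slack a≤b eq = ℤP.0≤i-j⇒j≤i (subst (0ℤ ≤_) eq (ℤP.i≤j⇒0≤j-i a≤b))

≰⇒+1≤ : ∀ {a b} → ¬ (a ≤ b) → b + 1ℤ ≤ a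
≰⇒+1≤ {a} {b} a≰b = subst (_≤ a) (ℤP.+-comm 1ℤ b) (ℤP.i<j⇒suc[i]≤j (ℤP.≰⇒> a≰b))

sumℤ-cong : ∀ {n} {f g : Fin n → ℤ} → (∀ j → f j ≡ g j) → sumℤ f ≡ sumℤ g
sumℤ-cong {zero}  f≗g = refl
sumℤ-cong {suc n} f≗g = cong₂ _+_ (f≗g zero) (sumℤ-cong (f≗g ∘ suc))

sumℤ-mono-≤ : ∀ {n} {f g : Fin n → ℤ} → (∀ j → f j ≤ g j) → sumℤ f ≤ sumℤ g
sumℤ-mono-≤ {zero}  f≤g = ℤP.≤-refl
sumℤ-mono-≤ {suc n} f≤g = ℤP.+-mono-≤ (f≤g zero) (sumℤ-mono-≤ (f≤g ∘ suc))

sumℤ-⊕ : ∀ {n} (f g : Div n) → sumℤ (f ⊕ g) ≡ sumℤ f + sumℤ g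
sumℤ-⊕ {zero}  f g = refl
sumℤ-⊕ {suc n} f g = trans (cong (λ s → (f zero + g zero) + s) (sumℤ-⊕ (f ∘ suc) (g ∘ suc)))
                           (interchange (f zero) (g zero) _ _)
  where
  interchange : ∀ a b s t → (a + b) + (s + t) ≡ (a + s) + (b + t)
  interchange = solve-∀

sumℤ-⊖ : ∀ {n} (f g : Div n) → sumℤ (f ⊖ g) ≡ sumℤ f - sumℤ g
sumℤ-⊖ {zero}  f g = refl
sumℤ-⊖ {suc n} f g = trans (cong (λ s → (f zero - g zero) + s) (sumℤ-⊖ (f ∘ suc) (g ∘ suc)))
                           (interchange (f zero) (g zero) _ _)
  where
  interchange : ∀ a b s t → (a - b) + (s - t) ≡ (a + s) - (b + t)
  interchange = solve-∀

sumℤ-const : ∀ n c → sumℤ {n} (λ _ → c) ≡ + n * c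
sumℤ-const zero    c = refl
sumℤ-const (suc n) c = trans (cong (λ s → c + s) (sumℤ-const n c)) (distrib c (+ n))
  where
  distrib : ∀ c m → c + m * c ≡ (1ℤ + m) * c
  distrib = solve-∀

sumℤ-zero : ∀ n → sumℤ {n} (λ _ → 0ℤ) ≡ 0ℤ
sumℤ-zero n = trans (sumℤ-const n 0ℤ) (ℤP.*-zeroʳ (+ n))

sumℤ≡sum : ∀ {n} (f : Fin n → ℤ) → sumℤ f ≡ ℤSum.sum f
sumℤ≡sum {zero}  f = refl
sumℤ≡sum {suc n} f = cong (λ s → f zero + s) (sumℤ≡sum (f ∘ suc))

sumℤ-permute : ∀ {n} (f : Fin n → ℤ) (π : Permutation′ n) → sumℤ (λ l → f (π ⟨$⟩ʳ l)) ≡ sumℤ f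
sumℤ-permute f π = begin
  sumℤ (λ l → f (π ⟨$⟩ʳ l)) ≡⟨ sumℤ≡sum (λ l → f (π ⟨$⟩ʳ l)) ⟩
  ℤSum.sum (λ l → f (π ⟨$⟩ʳ l)) ≡⟨ sym (ℤSum.sum-permute f π) ⟩
  ℤSum.sum f ≡⟨ sym (sumℤ≡sum f) ⟩
  sumℤ f ∎
  where open ≡-Reasoning

sumℤ-↑ : ∀ m {n} (f : Fin (m ℕ.+ n) → ℤ) → sumℤ f ≡ sumℤ (λ l → f (l ↑ˡ n)) + sumℤ (λ i → f (m ↑ʳ i))
sumℤ-↑ zero    f = sym (ℤP.+-identityˡ (sumℤ f))
sumℤ-↑ (suc m) f = trans (cong (λ s → f zero + s) (sumℤ-↑ m (f ∘ suc))) (sym (ℤP.+-assoc (f zero) _ _))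

sumℕ-cong : ∀ {n} {f g : Fin n → ℕ} → (∀ j → f j ≡ g j) → sumℕ f ≡ sumℕ g
sumℕ-cong {zero}  f≗g = refl
sumℕ-cong {suc n} f≗g = cong₂ ℕ._+_ (f≗g zero) (sumℕ-cong (f≗g ∘ suc))

sumℕ-mono-≤ : ∀ {n} {f g : Fin n → ℕ} → (∀ j → f j ℕ.≤ g j) → sumℕ f ℕ.≤ sumℕ g
sumℕ-mono-≤ {zero}  f≤g = ℕ.z≤n
sumℕ-mono-≤ {suc n} f≤g = ℕP.+-mono-≤ (f≤g zero) (sumℕ-mono-≤ (f≤g ∘ suc))

sumℕ-∣∣ : ∀ {n} (f : Fin n → ℤ) → (∀ j → 0ℤ ≤ f j) → + sumℕ (λ j → ∣ f j ∣) ≡ sumℤ f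
sumℕ-∣∣ {zero}  f f≥0 = refl
sumℕ-∣∣ {suc n} f f≥0 = trans (ℤP.pos-+ ∣ f zero ∣ _)
  (cong₂ _+_ (ℤP.0≤i⇒+∣i∣≡i (f≥0 zero)) (sumℕ-∣∣ (f ∘ suc) (f≥0 ∘ suc)))

𝐞-same : ∀ {n} (j : Fin n) → 𝐞 j j ≡ 1ℤ
𝐞-same j with j ≟ j
... | yes _   = refl
... | no j≢j = contradiction refl j≢j

𝐞-other : ∀ {n} {j l : Fin n} → l ≢ j → 𝐞 j l ≡ 0ℤ
𝐞-other {j = j} {l} l≢j with j ≟ l
... | yes j≡l = contradiction (sym j≡l) l≢j
... | no _    = refl

𝐞-suc : ∀ {n} (j l : Fin n) → 𝐞 (suc j) (suc l) ≡ 𝐞 j l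
𝐞-suc j l = by-cases (j ≟ l)
  where
  by-cases : Dec (j ≡ l) → 𝐞 (suc j) (suc l) ≡ 𝐞 j l
  by-cases (yes j≡l) = subst (λ k → 𝐞 (suc j) (suc k) ≡ 𝐞 j k) j≡l (trans (𝐞-same (suc j)) (sym (𝐞-same j)))
  by-cases (no j≢l)  = trans (𝐞-other (λ e → j≢l (sym (FinP.suc-injective e)))) (sym (𝐞-other (j≢l ∘ sym)))

sumℤ-𝐞 : ∀ {n} (j : Fin n) → sumℤ (𝐞 j) ≡ 1ℤ
sumℤ-𝐞 {suc n} zero    =
  cong (λ s → 1ℤ + s) (trans (sumℤ-cong {n} (λ l → 𝐞-other {j = zero} {suc l} (λ ()))) (sumℤ-zero n))
sumℤ-𝐞 {suc n} (suc j) = trans (ℤP.+-identityˡ _) (trans (sumℤ-cong (𝐞-suc j)) (sumℤ-𝐞 j))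

deg-⊕𝐞 : ∀ {n} (D : Div n) v → deg (D ⊕ 𝐞 v) ≡ deg D + 1ℤ
deg-⊕𝐞 D v = trans (sumℤ-⊕ D (𝐞 v)) (cong (λ s → deg D + s) (sumℤ-𝐞 v))

deg-⊖𝐞 : ∀ {n} (D : Div n) v → deg (D ⊖ 𝐞 v) ≡ deg D - 1ℤ
deg-⊖𝐞 D v = trans (sumℤ-⊖ D (𝐞 v)) (cong (deg D -_) (sumℤ-𝐞 v))

𝐞-nonneg : ∀ {n} (j l : Fin n) → 0ℤ ≤ 𝐞 j l
𝐞-nonneg j l with j ≟ l
... | yes _ = ℤ.+≤+ ℕ.z≤n
... | no _  = ℤ.+≤+ ℕ.z≤n

⊖𝐞-≤ : ∀ {n} (D : Div n) v → D ⊖ 𝐞 v ≤ᵈ D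
⊖𝐞-≤ D v l = ≤-resp-slack (𝐞-nonneg v l) (slack (D l) (𝐞 v l))
  where
  slack : ∀ a e → e - 0ℤ ≡ a - (a - e)
  slack = solve-∀

module _ {n} (D : Div n) (v : Fin n) where

  ⊕𝐞-same : (D ⊕ 𝐞 v) v ≡ D v + 1ℤ
  ⊕𝐞-same = cong (λ s → D v + s) (𝐞-same v)

  ⊕𝐞-other : ∀ {l} → l ≢ v → (D ⊕ 𝐞 v) l ≡ D l
  ⊕𝐞-other {l} l≢v = trans (cong (λ s → D l + s) (𝐞-other l≢v)) (ℤP.+-identityʳ (D l))

  ⊖𝐞-same : (D ⊖ 𝐞 v) v ≡ D v - 1ℤ
  ⊖𝐞-same = cong (D v -_) (𝐞-same v)

  ⊖𝐞-other : ∀ {l} → l ≢ v → (D ⊖ 𝐞 v) l ≡ D l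
  ⊖𝐞-other {l} l≢v = trans (cong (D l -_) (𝐞-other l≢v)) (ℤP.+-identityʳ (D l))

transpose-here : ∀ {n} (i j : Fin n) → PC.transpose i j i ≡ j
transpose-here i j with i ≟ i
... | yes _   = refl
... | no i≢i = contradiction refl i≢i

transpose-there : ∀ {n} (i j : Fin n) → PC.transpose i j j ≡ i
transpose-there i j with j ≟ i
... | yes j≡i = j≡i
... | no _ with j ≟ j
...   | yes _   = refl
...   | no j≢j = contradiction refl j≢j

transpose-elsewhere : ∀ {n} {i j k : Fin n} → k ≢ i → k ≢ j → PC.transpose i j k ≡ k
transpose-elsewhere {i = i} {j} {k} k≢i k≢j with k ≟ i
... | yes k≡i = contradiction k≡i k≢i
... | no _ with k ≟ j
...   | yes k≡j = contradiction k≡j k≢j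
...   | no _    = refl

dist₁-below : ∀ {n} {d F : Div n} → F ≤ᵈ d → + dist₁ d F ≡ deg d - deg F
dist₁-below {d = d} {F} F≤d = trans (sumℕ-∣∣ (d ⊖ F) (λ l → ℤP.i≤j⇒0≤j-i (F≤d l))) (sumℤ-⊖ d F)

dist₁-⊓ : ∀ {n} (d D : Div n) → dist₁ d (λ l → D l ⊓ d l) ℕ.≤ dist₁ d D
dist₁-⊓ d D = sumℕ-mono-≤ pointwise
  where
  pointwise : ∀ l → ∣ d l - D l ⊓ d l ∣ ℕ.≤ ∣ d l - D l ∣
  pointwise l with D l ℤ.≤? d l
  ... | yes D≤d rewrite ℤP.i≤j⇒i⊓j≡i D≤d = ℕP.≤-refl
  ... | no D≰d rewrite ℤP.i≥j⇒i⊓j≡j (ℤP.<⇒≤ (ℤP.≰⇒> D≰d)) | ℤP.+-inverseʳ (d l) = ℕ.z≤n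

-- The distance to 𝒩 on an arbitrary graph

module _ {n} (A : Adj n) where

  InN-antitone : ∀ {D E} → D ≤ᵈ E → InN A E → InN A D
  InN-antitone {D} {E} D≤E E∈𝒩 (e , e≥0 , x , D-e≡Δx) =
    E∈𝒩 ( e ⊕ (E ⊖ D) , (λ l → ℤP.+-mono-≤ (e≥0 l) (ℤP.i≤j⇒0≤j-i (D≤E l)))
        , x , λ l → trans (shift (E l) (D l) (e l)) (D-e≡Δx l))
    where
    shift : ∀ a b c → a - (c + (a - b)) ≡ b - c
    shift = solve-∀

  nonneg-∉𝒩 : ∀ {D} → Nonneg D → ¬ InN A D
  nonneg-∉𝒩 {D} D≥0 D∈𝒩 =
    D∈𝒩 (D , D≥0 , (λ _ → 0ℤ) , λ l → trans (ℤP.+-inverseʳ (D l)) (sym (Δ0≡0 l)))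
    where
    Δ0≡0 : ∀ l → laplacian A (λ _ → 0ℤ) l ≡ 0ℤ
    Δ0≡0 l = trans (sumℤ-cong (λ j → ℤP.*-zeroʳ (+ A l j))) (sumℤ-zero n)

  IsF-cong : ∀ {d e m} → (∀ j → d j ≡ e j) → IsF A d m → IsF A e m
  IsF-cong {d} {e} d≗e ((D , D∈𝒩 , dist≡m) , minimal) =
    (D , D∈𝒩 , trans (sumℕ-cong (λ l → cong (λ t → ∣ t - D l ∣) (sym (d≗e l)))) dist≡m) ,
    λ D' D'∈𝒩 → subst (_ ℕ.≤_) (sumℕ-cong (λ l → cong (λ t → ∣ t - D' l ∣) (d≗e l))) (minimal D' D'∈𝒩)

  IsRankBN-cong : ∀ {d e r} → (∀ j → d j ≡ e j) → IsRankBN A d r → IsRankBN A e r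
  IsRankBN-cong d≗e (m , F , r≡m-1) = m , IsF-cong d≗e F , r≡m-1

  -- With IsF-bound-below: deg d − f(d) is the largest degree of a divisor of 𝒩 below d.
  IsF-attained-below : ∀ {d m} → IsF A d m → Σ (Div n) λ D → InN A D × D ≤ᵈ d × deg d - + m ≤ deg D
  IsF-attained-below {d} {m} ((D , D∈𝒩 , dist≡m) , _) =
    D⊓d , InN-antitone (λ l → ℤP.i⊓j≤i (D l) (d l)) D∈𝒩 , D⊓d≤d ,
    ≤-resp-slack dist≤m (slack (deg d) (deg D⊓d) (+ m))
    where
    D⊓d : Div n
    D⊓d l = D l ⊓ d l
    D⊓d≤d : D⊓d ≤ᵈ d
    D⊓d≤d l = ℤP.i⊓j≤j (D l) (d l)
    dist≤m : deg d - deg D⊓d ≤ + m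
    dist≤m = subst (_≤ + m) (dist₁-below D⊓d≤d)
               (ℤ.+≤+ (subst (dist₁ d D⊓d ℕ.≤_) dist≡m (dist₁-⊓ d D)))
    slack : ∀ a b c → c - (a - b) ≡ b - (a - c)
    slack = solve-∀

  IsF-bound-below : ∀ {e m E} → IsF A e m → InN A E → E ≤ᵈ e → deg E ≤ deg e - + m
  IsF-bound-below {e} {m} {E} (_ , minimal) E∈𝒩 E≤e =
    ≤-resp-slack (subst (+ m ≤_) (dist₁-below E≤e) (ℤ.+≤+ (minimal E E∈𝒩))) (slack (deg e) (deg E) (+ m))
    where
    slack : ∀ a b c → (a - b) - c ≡ (a - c) - b
    slack = solve-∀

  -- The transfer may be classical: the descent on Kₙ cannot decide membership in 𝒩.
  IsF-compare : ∀ {d e m m'} (c : ℤ) → IsF A d m → IsF A e m'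
    → (∀ D → InN A D → D ≤ᵈ d → ¬ ¬ (Σ (Div n) λ E → InN A E × E ≤ᵈ e × deg D + c ≤ deg E))
    → (deg d - + m) + c ≤ deg e - + m'
  IsF-compare {d} {e} {m} {m'} c F F' transfer with IsF-attained-below F
  ... | D , D∈𝒩 , D≤d , gd≤D = decidable-stable (_ ℤ.≤? _) λ ¬goal →
    transfer D D∈𝒩 D≤d λ (E , E∈𝒩 , E≤e , D+c≤E) → ¬goal (begin
      (deg d - + m) + c ≤⟨ ℤP.+-monoˡ-≤ c gd≤D ⟩
      deg D + c         ≤⟨ D+c≤E ⟩
      deg E             ≤⟨ IsF-bound-below F' E∈𝒩 E≤e ⟩
      deg e - + m'      ∎)
    where open ℤP.≤-Reasoning

  IsF-⊖𝐞-upper : ∀ {d m m'} v → IsF A d m → IsF A (d ⊖ 𝐞 v) m'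
    → (deg d - 1ℤ) - + m' ≤ deg d - + m
  IsF-⊖𝐞-upper {d} {m} {m'} v F F' =
    subst₂ (λ a b → a ≤ b) (trans (ℤP.+-identityʳ _) (cong (_- + m') (deg-⊖𝐞 d v))) refl
      (IsF-compare 0ℤ F' F λ D D∈𝒩 D≤d' ¬E →
        ¬E (D , D∈𝒩 , (λ l → ℤP.≤-trans (D≤d' l) (⊖𝐞-≤ d v l)) , ℤP.≤-reflexive (ℤP.+-identityʳ (deg D))))

  IsF-⊖𝐞-lower : ∀ {d m m'} v → IsF A d m → IsF A (d ⊖ 𝐞 v) m'
    → deg d - + m ≤ ((deg d - 1ℤ) - + m') + 1ℤ
  IsF-⊖𝐞-lower {d} {m} {m'} v F F' =
    ≤-resp-slack (subst (λ δ → (deg d - + m) + -1ℤ ≤ δ - + m') (deg-⊖𝐞 d v) shifted)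
                 (slack (deg d - + m) ((deg d - 1ℤ) - + m'))
    where
    shifted : (deg d - + m) + -1ℤ ≤ deg (d ⊖ 𝐞 v) - + m'
    shifted = IsF-compare -1ℤ F F' λ D D∈𝒩 D≤d ¬E →
      ¬E ( D ⊖ 𝐞 v , InN-antitone (⊖𝐞-≤ D v) D∈𝒩 , (λ l → ℤP.+-monoˡ-≤ (ℤ.- 𝐞 v l) (D≤d l))
         , ℤP.≤-reflexive (sym (deg-⊖𝐞 D v)))
    slack : ∀ a b → b - (a + -1ℤ) ≡ (b + 1ℤ) - a
    slack = solve-∀

distinct⇒2≤n : ∀ {n} {v w : Fin n} → v ≢ w → 2 ℕ.≤ n
distinct⇒2≤n {suc zero}    {zero} {zero} v≢w = contradiction refl v≢w
distinct⇒2≤n {suc (suc n)} _                 = ℕ.s≤s (ℕ.s≤s ℕ.z≤n)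

rank-difference : ∀ δ m m' s → δ - + m ≡ ((δ - 1ℤ) - + m') + s → (+ m - 1ℤ) - (+ m' - 1ℤ) ≡ 1ℤ - s
rank-difference δ m m' s g≡g'+s = begin
  (+ m - 1ℤ) - (+ m' - 1ℤ)                       ≡⟨ regroup δ (+ m) (+ m') ⟩
  (1ℤ + g') - (δ - + m)                          ≡⟨ cong (λ t → (1ℤ + g') - t) g≡g'+s ⟩
  (1ℤ + g') - (g' + s)                           ≡⟨ cancel g' s ⟩
  1ℤ - s                                         ∎
  where
  open ≡-Reasoning
  g' : ℤ
  g' = (δ - 1ℤ) - + m'
  regroup : ∀ δ a b → (a - 1ℤ) - (b - 1ℤ) ≡ (1ℤ + ((δ - 1ℤ) - b)) - (δ - a)
  regroup = solve-∀
  cancel : ∀ g s → (1ℤ + g) - (g + s) ≡ 1ℤ - s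
  cancel = solve-∀

secondDiff-steps : ∀ r₀ r₁ r₂ r₃ {s t} → r₀ - r₁ ≡ s → r₂ - r₃ ≡ t → secondDiff r₀ r₁ r₂ r₃ ≡ s - t
secondDiff-steps r₀ r₁ r₂ r₃ r₀-r₁≡s r₂-r₃≡t = trans (regroup r₀ r₁ r₂ r₃) (cong₂ _-_ r₀-r₁≡s r₂-r₃≡t)
  where
  regroup : ∀ a b c e → ((a - b) - c) + e ≡ (a - b) - (c - e)
  regroup = solve-∀

-- The complete graph

module CompleteGraph (n : ℕ) where

  Kₙ : Adj n
  Kₙ = completeAdj n

  laplacian-complete : ∀ x i → laplacian Kₙ x i ≡ + n * x i - sumℤ x
  laplacian-complete x i = begin
    sumℤ (λ j → + Kₙ i j * (x i - x j)) ≡⟨ sumℤ-cong {n} edge ⟩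
    sumℤ (λ j → x i - x j)               ≡⟨ sumℤ-⊖ {n} (λ _ → x i) x ⟩
    sumℤ {n} (λ _ → x i) - sumℤ x        ≡⟨ cong (_- sumℤ x) (sumℤ-const n (x i)) ⟩
    + n * x i - sumℤ x                   ∎
    where
    open ≡-Reasoning
    edge : ∀ j → + Kₙ i j * (x i - x j) ≡ x i - x j
    edge j with i ≟ j
    ... | yes refl = trans (ℤP.*-zeroˡ (x i - x i)) (sym (ℤP.+-inverseʳ (x i)))
    ... | no _     = ℤP.*-identityˡ (x i - x j)

  -- D − Δx is effective, where Δx = n·x − Σx is the Laplacian of Kₙ.
  Winnable : Div n → Set
  Winnable D = Σ (Div n) λ x → ∀ l → + n * x l ≤ D l + sumℤ x

  InN⇒¬Winnable : ∀ {D} → InN Kₙ D → ¬ Winnable D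
  InN⇒¬Winnable {D} D∈𝒩 (x , fire) =
    D∈𝒩 ( (λ l → D l - (+ n * x l - sumℤ x))
        , (λ l → ≤-resp-slack (fire l) (slack₁ (D l) (+ n * x l) (sumℤ x)))
        , x , λ l → trans (slack₂ (D l) (+ n * x l) (sumℤ x)) (sym (laplacian-complete x l)))
    where
    slack₁ : ∀ a p X → (a + X) - p ≡ (a - (p - X)) - 0ℤ
    slack₁ = solve-∀
    slack₂ : ∀ a p X → a - (a - (p - X)) ≡ p - X
    slack₂ = solve-∀

  ¬Winnable⇒InN : ∀ {D} → ¬ Winnable D → InN Kₙ D
  ¬Winnable⇒InN {D} ¬W (e , e≥0 , x , D-e≡Δx) =
    ¬W (x , λ l → ≤-resp-slack (e≥0 l)
      (solve-for-e (D l) (e l) (+ n * x l) (sumℤ x) (trans (D-e≡Δx l) (laplacian-complete x l))))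
    where
    solve-for-e : ∀ a b p X → a - b ≡ p - X → b - 0ℤ ≡ (a + X) - p
    solve-for-e a b p X a-b≡p-X = begin
      b - 0ℤ                 ≡⟨ solve-∀′ a b X ⟩
      (a + X) - ((a - b) + X) ≡⟨ cong (λ t → (a + X) - (t + X)) a-b≡p-X ⟩
      (a + X) - ((p - X) + X) ≡⟨ cong (λ t → (a + X) - t) (cancel p X) ⟩
      (a + X) - p             ∎
      where
      open ≡-Reasoning
      solve-∀′ : ∀ a b X → b - 0ℤ ≡ (a + X) - ((a - b) + X)
      solve-∀′ = solve-∀
      cancel : ∀ p X → (p - X) + X ≡ p
      cancel = solve-∀

  Winnable-cong : ∀ {D E} → (∀ l → D l ≡ E l) → Winnable D → Winnable E
  Winnable-cong D≗E (x , fire) = x , λ l → subst (λ t → + n * x l ≤ t + sumℤ x) (D≗E l) (fire l)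

  Winnable-permute : ∀ (π : Permutation′ n) {D} → Winnable D → Winnable (λ l → D (π ⟨$⟩ʳ l))
  Winnable-permute π {D} (x , fire) = (λ l → x (π ⟨$⟩ʳ l)) , λ l →
    subst (λ s → + n * x (π ⟨$⟩ʳ l) ≤ D (π ⟨$⟩ʳ l) + s) (sym (sumℤ-permute x π)) (fire (π ⟨$⟩ʳ l))

  Winnable-+Δ : ∀ y {D} → Winnable D → Winnable (λ l → D l + (+ n * y l - sumℤ y))
  Winnable-+Δ y {D} (x , fire) = x ⊕ y , λ l →
    ≤-resp-slack (fire l) (trans (slack (D l) (x l) (y l) (sumℤ x) (sumℤ y) (+ n))
                                 (cong (λ s → ((D l + (+ n * y l - sumℤ y)) + s) - + n * (x l + y l)) (sym (sumℤ-⊕ x y))))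
    where
    slack : ∀ a p q X Y N → (a + X) - N * p ≡ ((a + (N * q - Y)) + (X + Y)) - N * (p + q)
    slack = solve-∀

  InN-permute : ∀ (π : Permutation′ n) {D} → InN Kₙ D → InN Kₙ (λ l → D (π ⟨$⟩ʳ l))
  InN-permute π {D} D∈𝒩 = ¬Winnable⇒InN {λ l → D (π ⟨$⟩ʳ l)} λ W →
    InN⇒¬Winnable {D} D∈𝒩 (Winnable-cong (λ l → cong D (Perm.inverseʳ π))
                                         (Winnable-permute (Perm.flip π) {λ l → D (π ⟨$⟩ʳ l)} W))

  Winnable-⊕𝐞-tight : ∀ {E} v x → ¬ Winnable E → (∀ l → + n * x l ≤ (E ⊕ 𝐞 v) l + sumℤ x)
                    → + n * x v ≡ (E v + 1ℤ) + sumℤ x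
  Winnable-⊕𝐞-tight {E} v x ¬W fire = ℤP.≤-antisym upper lower
    where
    X : ℤ
    X = sumℤ x
    upper : + n * x v ≤ (E v + 1ℤ) + X
    upper = subst (λ t → + n * x v ≤ t + X) (⊕𝐞-same E v) (fire v)
    ¬fires-at-v : ¬ (+ n * x v ≤ E v + X)
    ¬fires-at-v fires-at-v = ¬W (x , fires)
      where
      fires : ∀ l → + n * x l ≤ E l + X
      fires l with l ≟ v
      ... | yes refl = fires-at-v
      ... | no l≢v   = subst (λ t → + n * x l ≤ t + X) (⊕𝐞-other E v l≢v) (fire l)
    lower : (E v + 1ℤ) + X ≤ + n * x v
    lower = subst (_≤ + n * x v) (regroup (E v) X) (≰⇒+1≤ ¬fires-at-v)
      where
      regroup : ∀ a X → (a + X) + 1ℤ ≡ (a + 1ℤ) + X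
      regroup = solve-∀

  exchange-partner : 2 ℕ.≤ n → ∀ {E} v x → ¬ Winnable E → (∀ l → + n * x l ≤ (E ⊕ 𝐞 v) l + sumℤ x)
                   → Σ (Fin n) λ j → j ≢ v × + n * x j ≡ E j + sumℤ x
  exchange-partner 2≤n {E} v x ¬W fire = j , j≢v , tight-j
    where
    X : ℤ
    X = sumℤ x
    -- x + 1 − e_v cannot witness that E is winnable; it does satisfy the inequality at v.
    x' : Div n
    x' = (x ⊕ (λ _ → 1ℤ)) ⊖ 𝐞 v
    Σx' : sumℤ x' ≡ (X + + n) - 1ℤ
    Σx' = trans (deg-⊖𝐞 (x ⊕ (λ _ → 1ℤ)) v)
            (cong (_- 1ℤ) (trans (sumℤ-⊕ x (λ _ → 1ℤ))
              (cong (λ s → X + s) (trans (sumℤ-const n 1ℤ) (ℤP.*-identityʳ (+ n))))))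
    violation : Σ (Fin n) λ j → ¬ (+ n * x' j ≤ E j + sumℤ x')
    violation = FinP.¬∀⟶∃¬ n _ (λ l → + n * x' l ℤ.≤? E l + sumℤ x') (λ fires → ¬W (x' , fires))
    j : Fin n
    j = proj₁ violation

    fires-at-v : + n * x' v ≤ E v + sumℤ x'
    fires-at-v = begin
      + n * x' v             ≡⟨ cong (+ n *_) (trans (⊖𝐞-same (x ⊕ (λ _ → 1ℤ)) v) (cancel (x v))) ⟩
      + n * x v              ≡⟨ Winnable-⊕𝐞-tight {E} v x ¬W fire ⟩
      (E v + 1ℤ) + X         ≤⟨ ≤-resp-slack (ℤ.+≤+ 2≤n) (slack (E v) X (+ n)) ⟩
      E v + ((X + + n) - 1ℤ) ≡⟨ cong (λ s → E v + s) (sym Σx') ⟩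
      E v + sumℤ x'          ∎
      where
      open ℤP.≤-Reasoning
      cancel : ∀ a → (a + 1ℤ) - 1ℤ ≡ a
      cancel = solve-∀
      slack : ∀ a X N → N - + 2 ≡ (a + ((X + N) - 1ℤ)) - ((a + 1ℤ) + X)
      slack = solve-∀

    j≢v : j ≢ v
    j≢v j≡v = proj₂ violation (subst (λ k → + n * x' k ≤ E k + sumℤ x') (sym j≡v) fires-at-v)

    tight-j : + n * x j ≡ E j + X
    tight-j = ℤP.≤-antisym (subst (λ t → + n * x j ≤ t + X) (⊕𝐞-other E v j≢v) (fire j))
                            (≤-resp-slack violated (slack (E j) (x j) X (+ n)))
      where
      violated : (E j + ((X + + n) - 1ℤ)) + 1ℤ ≤ + n * (x j + 1ℤ)
      violated = subst₂ (λ s t → (E j + s) + 1ℤ ≤ + n * t) Σx' (⊖𝐞-other (x ⊕ (λ _ → 1ℤ)) v j≢v)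
                        (≰⇒+1≤ (proj₂ violation))
      slack : ∀ a p X N → N * (p + 1ℤ) - ((a + ((X + N) - 1ℤ)) + 1ℤ) ≡ N * p - (a + X)
      slack = solve-∀

  -- E + v − j is carried to E by the transposition of v and j followed by
  -- adding the Laplacian of y = x − x ∘ (v j).
  Winnable-exchanged : ∀ {E} v j x → j ≢ v
    → + n * x v ≡ (E v + 1ℤ) + sumℤ x → + n * x j ≡ E j + sumℤ x
    → Winnable ((E ⊕ 𝐞 v) ⊖ 𝐞 j) → Winnable E
  Winnable-exchanged {E} v j x j≢v tight-v tight-j W* =
    Winnable-cong {λ l → E* (τ ⟨$⟩ʳ l) + (+ n * y l - sumℤ y)} {E}
      (λ l → trans (cong (λ s → E* (τ ⟨$⟩ʳ l) + (+ n * y l - s)) Σy≡0) (realign l (l ≟ v) (l ≟ j)))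
      (Winnable-+Δ y {λ l → E* (τ ⟨$⟩ʳ l)} (Winnable-permute τ {E*} W*))
    where
    X : ℤ
    X = sumℤ x
    E* : Div n
    E* = (E ⊕ 𝐞 v) ⊖ 𝐞 j
    τ : Permutation′ n
    τ = Perm.transpose v j
    y : Div n
    y l = x l - x (τ ⟨$⟩ʳ l)
    Σy≡0 : sumℤ y ≡ 0ℤ
    Σy≡0 = trans (sumℤ-⊖ x (λ l → x (τ ⟨$⟩ʳ l)))
                 (trans (cong (X -_) (sumℤ-permute x τ)) (ℤP.+-inverseʳ X))

    rebalance : ∀ a b c p q → + n * p ≡ (a + c) + X → + n * q ≡ b + X
              → (b - c) + (+ n * (p - q) - 0ℤ) ≡ a
    rebalance a b c p q tight-p tight-q = begin
      (b - c) + (+ n * (p - q) - 0ℤ)      ≡⟨ distrib b c p q (+ n) ⟩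
      (b - c) + (+ n * p - + n * q)       ≡⟨ cong₂ (λ s t → (b - c) + (s - t)) tight-p tight-q ⟩
      (b - c) + (((a + c) + X) - (b + X)) ≡⟨ cancel a b c X ⟩
      a                                   ∎
      where
      open ≡-Reasoning
      distrib : ∀ b c p q N → (b - c) + (N * (p - q) - 0ℤ) ≡ (b - c) + (N * p - N * q)
      distrib = solve-∀
      cancel : ∀ a b c X → (b - c) + (((a + c) + X) - (b + X)) ≡ a
      cancel = solve-∀

    realign : ∀ l → Dec (l ≡ v) → Dec (l ≡ j) → E* (τ ⟨$⟩ʳ l) + (+ n * y l - 0ℤ) ≡ E l
    realign l (yes refl) _ = begin
      E* (τ ⟨$⟩ʳ v) + (+ n * y v - 0ℤ)       ≡⟨ cong (λ k → E* k + (+ n * (x v - x k) - 0ℤ)) (transpose-here v j) ⟩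
      E* j + (+ n * (x v - x j) - 0ℤ)       ≡⟨ cong (λ t → t + (+ n * (x v - x j) - 0ℤ)) E*-at-j ⟩
      (E j - 1ℤ) + (+ n * (x v - x j) - 0ℤ) ≡⟨ rebalance (E v) (E j) 1ℤ (x v) (x j) tight-v tight-j ⟩
      E v                                   ∎
      where
      open ≡-Reasoning
      E*-at-j : E* j ≡ E j - 1ℤ
      E*-at-j = trans (⊖𝐞-same (E ⊕ 𝐞 v) j) (cong (_- 1ℤ) (⊕𝐞-other E v j≢v))
    realign l (no l≢v) (yes refl) = begin
      E* (τ ⟨$⟩ʳ j) + (+ n * y j - 0ℤ)              ≡⟨ cong (λ k → E* k + (+ n * (x j - x k) - 0ℤ)) (transpose-there v j) ⟩
      E* v + (+ n * (x j - x v) - 0ℤ)              ≡⟨ cong (λ t → t + (+ n * (x j - x v) - 0ℤ)) E*-at-v ⟩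
      ((E v + 1ℤ) - 0ℤ) + (+ n * (x j - x v) - 0ℤ) ≡⟨ rebalance (E j) (E v + 1ℤ) 0ℤ (x j) (x v) tight-j′ tight-v ⟩
      E j                                          ∎
      where
      open ≡-Reasoning
      E*-at-v : E* v ≡ (E v + 1ℤ) - 0ℤ
      E*-at-v = trans (⊖𝐞-other (E ⊕ 𝐞 v) j (j≢v ∘ sym)) (trans (⊕𝐞-same E v) (sym (ℤP.+-identityʳ _)))
      tight-j′ : + n * x j ≡ (E j + 0ℤ) + X
      tight-j′ = trans tight-j (cong (_+ X) (sym (ℤP.+-identityʳ (E j))))
    realign l (no l≢v) (no l≢j) = begin
      E* (τ ⟨$⟩ʳ l) + (+ n * y l - 0ℤ) ≡⟨ cong (λ k → E* k + (+ n * (x l - x k) - 0ℤ)) (transpose-elsewhere l≢v l≢j) ⟩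
      E* l + (+ n * (x l - x l) - 0ℤ) ≡⟨ cong (λ t → t + (+ n * (x l - x l) - 0ℤ)) E*-at-l ⟩
      E l + (+ n * (x l - x l) - 0ℤ)  ≡⟨ vanish (E l) (x l) (+ n) ⟩
      E l                             ∎
      where
      open ≡-Reasoning
      E*-at-l : E* l ≡ E l
      E*-at-l = trans (⊖𝐞-other (E ⊕ 𝐞 v) j l≢j) (⊕𝐞-other E v l≢v)
      vanish : ∀ a p N → a + (N * (p - p) - 0ℤ) ≡ a
      vanish = solve-∀

  exchange : 2 ℕ.≤ n → ∀ {E} v → ¬ Winnable E → Winnable (E ⊕ 𝐞 v)
           → Σ (Fin n) λ j → j ≢ v × ¬ Winnable ((E ⊕ 𝐞 v) ⊖ 𝐞 j)
  exchange 2≤n {E} v ¬W (x , fire) with exchange-partner 2≤n {E} v x ¬W fire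
  ... | j , j≢v , tight-j =
    j , j≢v , ¬W ∘ Winnable-exchanged {E} v j x j≢v (Winnable-⊕𝐞-tight {E} v x ¬W fire) tight-j

  InN-⊕𝐞 : ∀ {d E} v w → d w < 0ℤ → (∀ l → l ≢ w → d l < + n)
         → InN Kₙ E → E v ≡ -1ℤ → E ⊕ 𝐞 v ≤ᵈ d → InN Kₙ (E ⊕ 𝐞 v)
  InN-⊕𝐞 {d} {E} v w dw<0 d<n E∈𝒩 Ev≡-1 E⁺≤d = ¬Winnable⇒InN {E ⊕ 𝐞 v} ¬W⁺
    where
    ¬W⁺ : ¬ Winnable (E ⊕ 𝐞 v)
    ¬W⁺ (x , fire) with subst₂ _≤_ Σu≡0 Σ[0-𝐞w]≡-1 (sumℤ-mono-≤ u≤0-𝐞w)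
      where
      X : ℤ
      X = sumℤ x
      nxv≡X : + n * x v ≡ X
      nxv≡X = trans (Winnable-⊕𝐞-tight {E} v x (InN⇒¬Winnable {E} E∈𝒩) fire)
                    (trans (cong (λ t → (t + 1ℤ) + X) Ev≡-1) (ℤP.+-identityˡ X))
      -- u = x − x_v satisfies n·u ≤ E + v ≤ d, which forces u ≤ −e_w, whereas Σu = 0.
      u : Div n
      u l = x l - x v
      nu≤d : ∀ l → + n * u l ≤ d l
      nu≤d l = begin
        + n * (x l - x v)   ≡⟨ distrib (+ n) (x l) (x v) ⟩
        + n * x l - + n * x v ≡⟨ cong (λ t → + n * x l - t) nxv≡X ⟩
        + n * x l - X       ≤⟨ ≤-resp-slack (fire l) (slack ((E ⊕ 𝐞 v) l) (+ n * x l) X) ⟩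
        (E ⊕ 𝐞 v) l         ≤⟨ E⁺≤d l ⟩
        d l                 ∎
        where
        open ℤP.≤-Reasoning
        distrib : ∀ N p q → N * (p - q) ≡ N * p - N * q
        distrib = solve-∀
        slack : ∀ a p X → (a + X) - p ≡ a - (p - X)
        slack = solve-∀
      u≤0-𝐞w : ∀ l → u l ≤ 0ℤ - 𝐞 w l
      u≤0-𝐞w l with l ≟ w
      ... | yes refl = subst (λ t → u l ≤ 0ℤ - t) (sym (𝐞-same l))
                         (ℤP.i<j⇒i≤pred[j] (ℤP.*-cancelˡ-<-nonNeg (+ n)
                           (ℤP.≤-<-trans (nu≤d l) (subst (d l <_) (sym (ℤP.*-zeroʳ (+ n))) dw<0))))
      ... | no l≢w   = subst (λ t → u l ≤ 0ℤ - t) (sym (𝐞-other l≢w))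
                         (ℤP.i<j⇒i≤pred[j] (ℤP.*-cancelˡ-<-nonNeg (+ n)
                           (ℤP.≤-<-trans (nu≤d l) (subst (d l <_) (sym (ℤP.*-identityʳ (+ n))) (d<n l l≢w)))))
      Σu≡0 : sumℤ u ≡ 0ℤ
      Σu≡0 = trans (sumℤ-⊖ x (λ _ → x v))
               (trans (cong (X -_) (trans (sumℤ-const n (x v)) nxv≡X)) (ℤP.+-inverseʳ X))
      Σ[0-𝐞w]≡-1 : sumℤ (λ l → 0ℤ - 𝐞 w l) ≡ -1ℤ
      Σ[0-𝐞w]≡-1 = trans (sumℤ-⊖ (λ _ → 0ℤ) (𝐞 w)) (cong₂ _-_ (sumℤ-zero n) (sumℤ-𝐞 w))
    ... | ()

  -- Raise E at v while it stays in 𝒩; when E + v leaves 𝒩, continue from the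
  -- divisor E + v − j of the same degree provided by exchange.
  InN-tighten : 2 ℕ.≤ n → ∀ {b} v E → InN Kₙ E → E ≤ᵈ b
              → ¬ ¬ (Σ (Div n) λ E' → InN Kₙ E' × E' ≤ᵈ b × E' v ≡ b v × deg E ≤ deg E')
  InN-tighten 2≤n {b} v E E∈𝒩 E≤b = climb ∣ b v - E v ∣ E E∈𝒩 E≤b gap
    where
    Tight : Div n → Set
    Tight E = Σ (Div n) λ E' → InN Kₙ E' × E' ≤ᵈ b × E' v ≡ b v × deg E ≤ deg E'

    from-higher : ∀ {E F} → deg E ≤ deg F → Tight F → Tight E
    from-higher E≤F (E' , E'∈𝒩 , E'≤b , tight , F≤E') = E' , E'∈𝒩 , E'≤b , tight , ℤP.≤-trans E≤F F≤E'

    gap : E v + + ∣ b v - E v ∣ ≡ b v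
    gap = trans (cong (λ t → E v + t) (ℤP.0≤i⇒+∣i∣≡i (ℤP.i≤j⇒0≤j-i (E≤b v)))) (cancel (E v) (b v))
      where
      cancel : ∀ a b → a + (b - a) ≡ b
      cancel = solve-∀

    climb : ∀ t E → InN Kₙ E → E ≤ᵈ b → E v + + t ≡ b v → ¬ ¬ Tight E
    climb zero    E E∈𝒩 E≤b gap ¬tight =
      ¬tight (E , E∈𝒩 , E≤b , trans (sym (ℤP.+-identityʳ (E v))) gap , ℤP.≤-refl)
    climb (suc t) E E∈𝒩 E≤b gap ¬tight = climb t E⁺ E⁺∈𝒩 E⁺≤b gap⁺ (¬tight ∘ from-higher E≤E⁺)
      where
      E⁺ : Div n
      E⁺ = E ⊕ 𝐞 v
      E≤E⁺ : deg E ≤ deg E⁺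
      E≤E⁺ = subst (deg E ≤_) (sym (deg-⊕𝐞 E v)) (ℤP.i≤i+j (deg E) 1ℤ)
      E⁺≤b : E⁺ ≤ᵈ b
      E⁺≤b l with l ≟ v
      ... | yes refl = subst₂ _≤_ (sym (⊕𝐞-same E l)) gap (ℤP.+-monoʳ-≤ (E l) (ℤ.+≤+ (ℕ.s≤s ℕ.z≤n)))
      ... | no l≢v   = subst (_≤ b l) (sym (⊕𝐞-other E v l≢v)) (E≤b l)
      gap⁺ : E⁺ v + + t ≡ b v
      gap⁺ = trans (cong (_+ + t) (⊕𝐞-same E v)) (trans (ℤP.+-assoc (E v) 1ℤ (+ t)) gap)
      E⁺∈𝒩 : InN Kₙ E⁺
      E⁺∈𝒩 = ¬Winnable⇒InN {E⁺} λ W⁺ → escape (exchange 2≤n {E} v (InN⇒¬Winnable {E} E∈𝒩) W⁺)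
        where
        escape : (Σ (Fin n) λ j → j ≢ v × ¬ Winnable (E⁺ ⊖ 𝐞 j)) → ⊥
        escape (j , j≢v , ¬W*) =
          climb t (E⁺ ⊖ 𝐞 j) (¬Winnable⇒InN {E⁺ ⊖ 𝐞 j} ¬W*) (λ l → ℤP.≤-trans (⊖𝐞-≤ E⁺ j l) (E⁺≤b l))
                (trans (cong (_+ + t) (⊖𝐞-other E⁺ j (j≢v ∘ sym))) gap⁺)
                (¬tight ∘ from-higher (ℤP.≤-reflexive (sym (deg-exchanged j))))
          where
          deg-exchanged : ∀ j → deg (E⁺ ⊖ 𝐞 j) ≡ deg E
          deg-exchanged j = trans (deg-⊖𝐞 E⁺ j) (trans (cong (_- 1ℤ) (deg-⊕𝐞 E v)) (cancel (deg E)))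
            where
            cancel : ∀ a → (a + 1ℤ) - 1ℤ ≡ a
            cancel = solve-∀

  InN-below-⊖𝐞 : ∀ {d} v → d v ≡ 0ℤ → Nonneg d → ∀ D → InN Kₙ D → D ≤ᵈ d
               → Σ (Div n) λ E → InN Kₙ E × E ≤ᵈ d ⊖ 𝐞 v × deg D + 0ℤ ≤ deg E
  InN-below-⊖𝐞 {d} v dv≡0 d≥0 D D∈𝒩 D≤d with D v ℤ.<? 0ℤ
  ... | yes Dv<0 = D , D∈𝒩 , D≤d' , ℤP.≤-reflexive (ℤP.+-identityʳ (deg D))
    where
    D≤d' : D ≤ᵈ d ⊖ 𝐞 v
    D≤d' l with l ≟ v
    ... | yes refl = subst (D l ≤_) (sym (trans (⊖𝐞-same d l) (cong (_- 1ℤ) dv≡0))) (ℤP.i<j⇒i≤pred[j] Dv<0)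
    ... | no l≢v   = subst (D l ≤_) (sym (⊖𝐞-other d v l≢v)) (D≤d l)
  ... | no Dv≮0 = (λ l → D (τ ⟨$⟩ʳ l)) , InN-permute τ {D} D∈𝒩 , Dτ≤d'
                , ℤP.≤-reflexive (trans (ℤP.+-identityʳ (deg D)) (sym (sumℤ-permute D τ)))
    where
    -- D ∈ 𝒩 is not effective, and D v = 0: swap v with a vertex where D is negative.
    negative : Σ (Fin n) λ j → ¬ (0ℤ ≤ D j)
    negative = FinP.¬∀⟶∃¬ n (λ l → 0ℤ ≤ D l) (λ l → 0ℤ ℤ.≤? D l) (λ D≥0 → nonneg-∉𝒩 Kₙ D≥0 D∈𝒩)
    j : Fin n
    j = proj₁ negative
    Dj≤-1 : D j ≤ -1ℤ
    Dj≤-1 = ℤP.i<j⇒i≤pred[j] (ℤP.≰⇒> (proj₂ negative))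
    Dv≡0 : D v ≡ 0ℤ
    Dv≡0 = ℤP.≤-antisym (subst (D v ≤_) dv≡0 (D≤d v)) (ℤP.≮⇒≥ Dv≮0)
    j≢v : j ≢ v
    j≢v j≡v = proj₂ negative (subst (λ k → 0ℤ ≤ D k) (sym j≡v) (ℤP.≤-reflexive (sym Dv≡0)))
    τ : Permutation′ n
    τ = Perm.transpose v j
    Dτ≤d'-by-cases : ∀ l → Dec (l ≡ v) → Dec (l ≡ j) → D (τ ⟨$⟩ʳ l) ≤ (d ⊖ 𝐞 v) l
    Dτ≤d'-by-cases l (yes refl) _ =
      subst₂ _≤_ (cong D (sym (transpose-here v j))) (sym (trans (⊖𝐞-same d v) (cong (_- 1ℤ) dv≡0))) Dj≤-1
    Dτ≤d'-by-cases l (no l≢v) (yes refl) =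
      subst₂ _≤_ (trans (sym Dv≡0) (cong D (sym (transpose-there v j)))) (sym (⊖𝐞-other d v l≢v)) (d≥0 j)
    Dτ≤d'-by-cases l (no l≢v) (no l≢j) =
      subst₂ _≤_ (cong D (sym (transpose-elsewhere l≢v l≢j))) (sym (⊖𝐞-other d v l≢v)) (D≤d l)
    Dτ≤d' : (λ l → D (τ ⟨$⟩ʳ l)) ≤ᵈ d ⊖ 𝐞 v
    Dτ≤d' l = Dτ≤d'-by-cases l (l ≟ v) (l ≟ j)

  InN-below-⊕𝐞 : ∀ {d} v w → v ≢ w → d v ≡ 0ℤ → d w < 0ℤ → (∀ l → l ≢ w → d l < + n)
               → ∀ E → InN Kₙ E → E ≤ᵈ d ⊖ 𝐞 v
               → ¬ ¬ (Σ (Div n) λ D → InN Kₙ D × D ≤ᵈ d × deg E + 1ℤ ≤ deg D)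
  InN-below-⊕𝐞 {d} v w v≢w dv≡0 dw<0 d<n E E∈𝒩 E≤d' ¬goal =
    InN-tighten (distinct⇒2≤n v≢w) v E E∈𝒩 E≤d' (¬goal ∘ raise)
    where
    raise : (Σ (Div n) λ E' → InN Kₙ E' × E' ≤ᵈ d ⊖ 𝐞 v × E' v ≡ (d ⊖ 𝐞 v) v × deg E ≤ deg E')
          → Σ (Div n) λ D → InN Kₙ D × D ≤ᵈ d × deg E + 1ℤ ≤ deg D
    raise (E' , E'∈𝒩 , E'≤d' , E'v≡d'v , E≤E') =
      E' ⊕ 𝐞 v , InN-⊕𝐞 {d} {E'} v w dw<0 d<n E'∈𝒩 E'v≡-1 E'⁺≤d , E'⁺≤d ,
      subst (deg E + 1ℤ ≤_) (sym (deg-⊕𝐞 E' v)) (ℤP.+-monoˡ-≤ 1ℤ E≤E')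
      where
      E'v≡-1 : E' v ≡ -1ℤ
      E'v≡-1 = trans E'v≡d'v (trans (⊖𝐞-same d v) (cong (_- 1ℤ) dv≡0))
      E'⁺≤d : E' ⊕ 𝐞 v ≤ᵈ d
      E'⁺≤d l with l ≟ v
      ... | yes refl = ℤP.≤-reflexive (trans (⊕𝐞-same E' l) (trans (cong (_+ 1ℤ) E'v≡-1) (sym dv≡0)))
      ... | no l≢v   = subst₂ _≤_ (sym (⊕𝐞-other E' v l≢v)) (⊖𝐞-other d v l≢v) (E'≤d' l)

  rankBN-step-nonneg : ∀ {d r r'} v → d v ≡ 0ℤ → Nonneg d
                     → IsRankBN Kₙ d r → IsRankBN Kₙ (d ⊖ 𝐞 v) r' → r - r' ≡ 1ℤ
  rankBN-step-nonneg {d} v dv≡0 d≥0 (m , F , refl) (m' , F' , refl) =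
    rank-difference (deg d) m m' 0ℤ (trans (ℤP.≤-antisym g≤g' (IsF-⊖𝐞-upper Kₙ v F F')) (sym (ℤP.+-identityʳ _)))
    where
    g≤g' : deg d - + m ≤ (deg d - 1ℤ) - + m'
    g≤g' = subst₂ (λ a δ → a ≤ δ - + m') (ℤP.+-identityʳ _) (deg-⊖𝐞 d v)
             (IsF-compare Kₙ 0ℤ F F' λ D D∈𝒩 D≤d ¬E → ¬E (InN-below-⊖𝐞 v dv≡0 d≥0 D D∈𝒩 D≤d))

  rankBN-step-neg : ∀ {d r r'} v w → v ≢ w → d v ≡ 0ℤ → d w < 0ℤ → (∀ l → l ≢ w → d l < + n)
                  → IsRankBN Kₙ d r → IsRankBN Kₙ (d ⊖ 𝐞 v) r' → r - r' ≡ 0ℤ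
  rankBN-step-neg {d} v w v≢w dv≡0 dw<0 d<n (m , F , refl) (m' , F' , refl) =
    rank-difference (deg d) m m' 1ℤ (ℤP.≤-antisym (IsF-⊖𝐞-lower Kₙ v F F') g'+1≤g)
    where
    g'+1≤g : ((deg d - 1ℤ) - + m') + 1ℤ ≤ deg d - + m
    g'+1≤g = subst (λ δ → (δ - + m') + 1ℤ ≤ deg d - + m) (deg-⊖𝐞 d v)
               (IsF-compare Kₙ 1ℤ F' F (InN-below-⊕𝐞 v w v≢w dv≡0 dw<0 d<n))

  SecondDiffRankAt : Fin n → Fin n → Div n → ℤ → Set
  SecondDiffRankAt v w d s =
    ∀ r₀ r₁ r₂ r₃ → IsRankBN Kₙ d r₀ → IsRankBN Kₙ (d ⊖ 𝐞 v) r₁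
    → IsRankBN Kₙ (d ⊖ 𝐞 w) r₂ → IsRankBN Kₙ ((d ⊖ 𝐞 v) ⊖ 𝐞 w) r₃
    → secondDiff r₀ r₁ r₂ r₃ ≡ s

  secondDiff-rankBN : ∀ {d} v w → v ≢ w → d v ≡ 0ℤ → (∀ l → l ≢ w → 0ℤ ≤ d l × d l < + n)
    → (d w ≡ 0ℤ → SecondDiffRankAt v w d 1ℤ) × (d w ≢ 0ℤ → SecondDiffRankAt v w d 0ℤ)
  secondDiff-rankBN {d} v w v≢w dv≡0 bounded = by-sign (ℤP.<-cmp 0ℤ (d w))
    where
    d₁ : Div n
    d₁ = d ⊖ 𝐞 w
    d₁v≡0 : d₁ v ≡ 0ℤ
    d₁v≡0 = trans (⊖𝐞-other d w v≢w) dv≡0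
    d<n : ∀ l → l ≢ w → d l < + n
    d<n l l≢w = proj₂ (bounded l l≢w)
    d₁<n : ∀ l → l ≢ w → d₁ l < + n
    d₁<n l l≢w = subst (_< + n) (sym (⊖𝐞-other d w l≢w)) (d<n l l≢w)
    nonneg-if : ∀ {e} → (∀ l → l ≢ w → e l ≡ d l) → 0ℤ ≤ e w → Nonneg e
    nonneg-if {e} e≡d 0≤ew l with l ≟ w
    ... | yes refl = 0≤ew
    ... | no l≢w   = subst (0ℤ ≤_) (sym (e≡d l l≢w)) (proj₁ (bounded l l≢w))
    commute : ∀ {r} → IsRankBN Kₙ ((d ⊖ 𝐞 v) ⊖ 𝐞 w) r → IsRankBN Kₙ (d₁ ⊖ 𝐞 v) r
    commute = IsRankBN-cong Kₙ (λ l → swap (d l) (𝐞 v l) (𝐞 w l))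
      where
      swap : ∀ a b c → (a - b) - c ≡ (a - c) - b
      swap = solve-∀

    step-nonneg : ∀ {r₀ r₁} → 0ℤ ≤ d w → IsRankBN Kₙ d r₀ → IsRankBN Kₙ (d ⊖ 𝐞 v) r₁ → r₀ - r₁ ≡ 1ℤ
    step-nonneg 0≤dw = rankBN-step-nonneg v dv≡0 (nonneg-if (λ _ _ → refl) 0≤dw)
    step-neg : ∀ {r₀ r₁} → d w < 0ℤ → IsRankBN Kₙ d r₀ → IsRankBN Kₙ (d ⊖ 𝐞 v) r₁ → r₀ - r₁ ≡ 0ℤ
    step-neg dw<0 = rankBN-step-neg v w v≢w dv≡0 dw<0 d<n
    step₁-nonneg : ∀ {r₂ r₃} → 0ℤ ≤ d w - 1ℤ → IsRankBN Kₙ d₁ r₂ → IsRankBN Kₙ ((d ⊖ 𝐞 v) ⊖ 𝐞 w) r₃ → r₂ - r₃ ≡ 1ℤ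
    step₁-nonneg 0≤dw-1 R₂ R₃ = rankBN-step-nonneg v d₁v≡0
      (nonneg-if (λ l l≢w → ⊖𝐞-other d w l≢w) (subst (0ℤ ≤_) (sym (⊖𝐞-same d w)) 0≤dw-1)) R₂ (commute R₃)
    step₁-neg : ∀ {r₂ r₃} → d w - 1ℤ < 0ℤ → IsRankBN Kₙ d₁ r₂ → IsRankBN Kₙ ((d ⊖ 𝐞 v) ⊖ 𝐞 w) r₃ → r₂ - r₃ ≡ 0ℤ
    step₁-neg dw-1<0 R₂ R₃ =
      rankBN-step-neg v w v≢w d₁v≡0 (subst (_< 0ℤ) (sym (⊖𝐞-same d w)) dw-1<0) d₁<n R₂ (commute R₃)

    by-sign : Tri (0ℤ < d w) (0ℤ ≡ d w) (d w < 0ℤ)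
            → (d w ≡ 0ℤ → SecondDiffRankAt v w d 1ℤ) × (d w ≢ 0ℤ → SecondDiffRankAt v w d 0ℤ)
    by-sign (tri< 0<dw _ _) =
      (λ dw≡0 → contradiction (sym dw≡0) (ℤP.<⇒≢ 0<dw)) ,
      λ _ r₀ r₁ r₂ r₃ R₀ R₁ R₂ R₃ → secondDiff-steps r₀ r₁ r₂ r₃
        (step-nonneg (ℤP.<⇒≤ 0<dw) R₀ R₁) (step₁-nonneg (ℤP.i≤j⇒0≤j-i (ℤP.i<j⇒suc[i]≤j 0<dw)) R₂ R₃)
    by-sign (tri≈ _ 0≡dw _) =
      (λ _ r₀ r₁ r₂ r₃ R₀ R₁ R₂ R₃ → secondDiff-steps r₀ r₁ r₂ r₃
        (step-nonneg (ℤP.≤-reflexive 0≡dw) R₀ R₁) (step₁-neg (subst (λ t → t - 1ℤ < 0ℤ) 0≡dw ℤ.-<+) R₂ R₃)) ,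
      λ dw≢0 → contradiction (sym 0≡dw) dw≢0
    by-sign (tri> _ _ dw<0) =
      (λ dw≡0 → contradiction dw≡0 (ℤP.<⇒≢ dw<0)) ,
      λ _ r₀ r₁ r₂ r₃ R₀ R₁ R₂ R₃ → secondDiff-steps r₀ r₁ r₂ r₃
        (step-neg dw<0 R₀ R₁) (step₁-neg (ℤP.≤-<-trans (ℤP.i-j≤i (d w) 1ℤ) dw<0) R₂ R₃)

-- The vertices v_{n−1}, v_n of K_{k+2}

vPen≢vLast : ∀ k → vPen k ≢ vLast k
vPen≢vLast k eq with FinP.↑ʳ-injective k zero (suc zero) eq
... | ()

vertex-cases : ∀ k (j : Fin (k ℕ.+ 2))
             → (Σ (Fin k) λ l → vLow k l ≡ j) ⊎ (vPen k ≡ j) ⊎ (vLast k ≡ j)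
vertex-cases k j with Fin.splitAt k j | FinP.join-splitAt k 2 j
... | inj₁ l          | eq = inj₁ (l , eq)
... | inj₂ zero       | eq = inj₂ (inj₁ eq)
... | inj₂ (suc zero) | eq = inj₂ (inj₂ eq)

deg-split : ∀ k (d : Div (k ℕ.+ 2)) → deg d ≡ (sumℤ (λ l → d (vLow k l)) + d (vPen k)) + d (vLast k)
deg-split k d = trans (sumℤ-↑ k d) (regroup (sumℤ (λ l → d (vLow k l))) (d (vPen k)) (d (vLast k)))
  where
  regroup : ∀ s a b → s + (a + (b + 0ℤ)) ≡ (s + a) + b
  regroup = solve-∀

secondDiffRank : ∀ k (d : Div (k ℕ.+ 2)) (S i : ℤ)
  → (∀ l → (0ℤ ≤ d (vLow k l)) × (d (vLow k l) ≤ + (k ℕ.+ 1)))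
  → d (vPen k) ≡ 0ℤ → d (vLast k) ≡ i - S
  → (S ≡ i → SecondDiffRankIs k d 1ℤ) × (S ≢ i → SecondDiffRankIs k d 0ℤ)
secondDiffRank k d S i low pen last≡i-S =
  Product.map (_∘ last≡0) (_∘ last≢0) (secondDiff-rankBN {d} (vPen k) (vLast k) (vPen≢vLast k) pen bounded)
  where
  open CompleteGraph (k ℕ.+ 2)
  bounded : ∀ j → j ≢ vLast k → 0ℤ ≤ d j × d j < + (k ℕ.+ 2)
  bounded j j≢last with vertex-cases k j
  ... | inj₁ (l , refl)  = proj₁ (low l) , ℤP.≤-<-trans (proj₂ (low l)) (ℤ.+<+ (ℕP.+-monoʳ-< k (ℕP.n<1+n 1)))
  ... | inj₂ (inj₁ refl) = subst (λ t → 0ℤ ≤ t × t < + (k ℕ.+ 2)) (sym pen)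
                                 (ℤP.≤-refl , ℤ.+<+ (ℕP.≤-trans (ℕ.s≤s ℕ.z≤n) (ℕP.m≤n+m 2 k)))
  ... | inj₂ (inj₂ refl) = contradiction refl j≢last
  last≡0 : S ≡ i → d (vLast k) ≡ 0ℤ
  last≡0 refl = trans last≡i-S (ℤP.+-inverseʳ S)
  last≢0 : S ≢ i → d (vLast k) ≢ 0ℤ
  last≢0 S≢i last≡0 = S≢i (sym (ℤP.i-j≡0⇒i≡j i S (trans (sym last≡i-S) last≡0)))

theorem6p15 : (k : ℕ)
    → ((a : Div (k ℕ.+ 2)) (i : ℤ)
        → (∀ (l : Fin k) → (+ 0 ≤ a (vLow k l)) × (a (vLow k l) ≤ + (k ℕ.+ 1)))
        → a (vPen k) ≡ + 0
        → deg a ≡ i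
        → (sumℤ (λ l → a (vLow k l)) ≡ i → SecondDiffRankIs k a (+ 1))
          × (¬ (sumℤ (λ l → a (vLow k l)) ≡ i) → SecondDiffRankIs k a (+ 0)))
    × ((b : Fin k → ℤ) (i : ℤ)
        → (∀ (l : Fin k) → (+ 0 ≤ b l) × (b l ≤ + (k ℕ.+ 1)))
        → (sumℤ b ≡ i → SecondDiffRankIs k ⟨ b , i ⟩ (+ 1))
          × (¬ (sumℤ b ≡ i) → SecondDiffRankIs k ⟨ b , i ⟩ (+ 0)))
theorem6p15 k =
  (λ a i low pen deg≡i →
     secondDiffRank k a _ i low pen (last≡ (trans (sym (deg-split k a)) deg≡i) pen)) ,
  (λ b i low →
     secondDiffRank k ⟨ b , i ⟩ (sumℤ b) i
       (λ l → subst (λ t → 0ℤ ≤ t × t ≤ + (k ℕ.+ 1)) (sym (⟨⟩-low b i l)) (low l)) (⟨⟩-pen b i) (⟨⟩-last b i))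
  where
  last≡ : ∀ {S p L i} → (S + p) + L ≡ i → p ≡ 0ℤ → L ≡ i - S
  last≡ {S} {L = L} refl refl = cancel S L
    where
    cancel : ∀ S L → L ≡ ((S + 0ℤ) + L) - S
    cancel = solve-∀
  ⟨⟩-low : (b : Fin k → ℤ) (i : ℤ) (l : Fin k) → ⟨ b , i ⟩ (vLow k l) ≡ b l
  ⟨⟩-low b i l rewrite FinP.splitAt-↑ˡ k l 2 = refl
  ⟨⟩-pen : (b : Fin k → ℤ) (i : ℤ) → ⟨ b , i ⟩ (vPen k) ≡ 0ℤ
  ⟨⟩-pen b i rewrite FinP.splitAt-↑ʳ k 2 zero = refl
  ⟨⟩-last : (b : Fin k → ℤ) (i : ℤ) → ⟨ b , i ⟩ (vLast k) ≡ i - sumℤ b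
  ⟨⟩-last b i rewrite FinP.splitAt-↑ʳ k 2 (suc zero) = refl
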